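{- For every integer $m\geq 1$ there exists $k_0=k_0(m)$ such that for all integers $k\geq k_0$, $$s_F(mL_k)<\frac{\log m}{\log\phi}+3,$$ where $\phi=\frac{1+\sqrt5}{2}$.
   Context: Let $(F_j)_{j\geq 0}$ be the Fibonacci numbers, $F_0=0$, $F_1=1$, $F_{j+1}=F_j+F_{j-1}$, and let $L_k=F_{k-1}+F_{k+1}$ be the Lucas numbers. Every positive integer $x$ has a unique Zeckendorf expansion $x=\sum_{2\leq j\leq M}\varepsilon_jF_j$ with $\varepsilon_M=1$, $\varepsilon_j\in\{0,1\}$ and no two adjacent digits equal to $1$. The Zeckendorf sum of digits is $s_F(x)=\sum_j\varepsilon_j$. $\log$ is the natural logarithm. -}

module Defs where

open import Data.Nat using (ℕ; zero; suc; _+_; _*_; _∸_; _<_)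
open import Data.Bool using (Bool; true; false)
open import Data.List using (List; []; _∷_)
open import Data.Product using (_×_)
open import Data.Unit using (⊤)
open import Data.Empty using (⊥)
open import Relation.Binary.PropositionalEquality using (_≡_)

fib : ℕ → ℕ
fib zero = zero
fib (suc zero) = suc zero
fib (suc (suc n)) = fib (suc n) + fib n

-- Lucas numbers L_k = F_{k-1} + F_{k+1}  (with F_{-1} = 1, so L_0 = 2)
lucas : ℕ → ℕ
lucas zero = 2
lucas (suc k) = fib k + fib (suc (suc k))

-- A digit string is a list (ε_j, ε_{j+1}, ...) ; value starting at index j
zval : ℕ → List Bool → ℕ
zval j [] = 0
zval j (true ∷ ds) = fib j + zval (suc j) ds
zval j (false ∷ ds) = zval (suc j) ds

NoAdjacent : List Bool → Set
NoAdjacent [] = ⊤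
NoAdjacent (true ∷ true ∷ ds) = ⊥
NoAdjacent (_ ∷ ds) = NoAdjacent ds

-- leading digit ε_M = 1 (the last entry of the list)
LastTrue : List Bool → Set
LastTrue [] = ⊥
LastTrue (b ∷ []) = b ≡ true
LastTrue (_ ∷ b ∷ ds) = LastTrue (b ∷ ds)

digitSum : List Bool → ℕ
digitSum [] = 0
digitSum (true ∷ ds) = suc (digitSum ds)
digitSum (false ∷ ds) = digitSum ds

-- ds = (ε_2, ..., ε_M) is the Zeckendorf expansion of x
IsZeckendorf : ℕ → List Bool → Set
IsZeckendorf x ds = NoAdjacent ds × LastTrue ds × zval 2 ds ≡ x

-- φ^n < m, where φ = (1+√5)/2.  Uses φ^n = (L_n + F_n √5)/2, so
-- φ^n < m  ⇔  L_n < 2m  and  5 F_n² < (2m − L_n)².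
PhiPowLt : ℕ → ℕ → Set
PhiPowLt n m = (lucas n < 2 * m) × (5 * (fib n * fib n) < (2 * m ∸ lucas n) * (2 * m ∸ lucas n))

-- Let D be the positions of the Zeckendorf digits of x = m L_n and K = 2n.  By d'Ocagne's
-- identity F_{e+1} F_K − F_e F_{K+1} = (−1)^e F_{K−e}, the signed sum Σ_{e∈D} (−1)^e F_{K−e} is
-- determined modulo F_K by x; for large n it is smaller than F_K, so it equals m times the same
-- sum for L_n = F_{n−1} + F_{n+1}, which is ±m L_n.  Split D at n.  If q ≥ 2 digits lie below n,
-- the leading one dominates the signed sum and F_{n+2q−1} ≤ F_{n+1} + m L_n; the same bound holds
-- if q ≥ 2 digits lie at or above n, since they sum to at most m L_n.  As F_j L_n = F_{n+j} + F_{n−j}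
-- for odd j, this forces F_{2q−1} ≤ m.  Hence a digit sum s ≥ 3 gives F_{s−1} ≤ m, i.e. φ^{s−3} < m.

module Submission where

open import Defs
open import Data.Nat
  using (ℕ; zero; suc; pred; _+_; _*_; _∸_; _<_; _≤_; _⊔_; z≤n; s≤s; s≤s⁻¹; _≤′_; ≤′-refl; ≤′-step; _<?_; parity)
open import Data.Nat.Properties
open import Data.Nat.DivMod using (_%_; m<n⇒m%n≡m; [m+kn]%n≡m%n)
open import Data.Nat.ListAction using (sum)
open import Data.Nat.ListAction.Properties using (sum-++)
open import Data.Nat.Tactic.RingSolver using (solve-∀)
open import Data.Parity.Base using (Parity; 0ℙ; 1ℙ; _⁻¹)
open import Data.Parity.Properties using (p≢p⁻¹; +-homo-+; p+p≡0ℙ)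
open import Data.Bool using (Bool; true; false)
open import Data.List using (List; []; _∷_; _++_; length; map)
open import Data.List.Properties using (map-++; length-++)
open import Data.List.Relation.Unary.All as All using (All; []; _∷_)
open import Data.List.Relation.Unary.All.Properties using (++⁻ʳ)
open import Data.Product using (_×_; _,_; ∃; ∃₂)
open import Data.Sum using (_⊎_; inj₁; inj₂)
open import Function using (_∘_)
open import Relation.Nullary using (yes; no)
open import Relation.Binary.PropositionalEquality

F : ℕ → ℕ
F = fib

fib-≤-suc : ∀ n → F n ≤ F (suc n)
fib-≤-suc zero = z≤n
fib-≤-suc (suc n) = m≤m+n (F (suc n)) (F n)

fib-mono-≤ : ∀ {m n} → m ≤ n → F m ≤ F n
fib-mono-≤ = go ∘ ≤⇒≤′
  where
  go : ∀ {m n} → m ≤′ n → F m ≤ F n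
  go ≤′-refl = ≤-refl
  go (≤′-step {n = n} p) = ≤-trans (go p) (fib-≤-suc n)

fib-suc-pos : ∀ n → 1 ≤ F (suc n)
fib-suc-pos zero = ≤-refl
fib-suc-pos (suc n) = ≤-trans (fib-suc-pos n) (fib-≤-suc (suc n))

n<fib-2+n : ∀ n → n < F (2 + n)
n<fib-2+n zero = ≤-refl
n<fib-2+n (suc n) =
  subst (suc (suc n) ≤_) (+-comm (F (suc n)) (F (2 + n))) (+-mono-≤ (fib-suc-pos n) (n<fib-2+n n))

fib-cancel-< : ∀ {m n} → F m < F n → m < n
fib-cancel-< Fm<Fn = ≰⇒> (λ n≤m → <⇒≱ Fm<Fn (fib-mono-≤ n≤m))

fib-+-≤ : ∀ {i j d} → suc i ≤ d → suc (suc j) ≤ d → F i + F j ≤ F d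
fib-+-≤ {d = suc (suc d)} (s≤s i≤d+1) (s≤s (s≤s j≤d)) =
  +-mono-≤ (fib-mono-≤ i≤d+1) (fib-mono-≤ j≤d)

fib-+-pred : ∀ d → F d + F (pred d) ≤ F (suc d)
fib-+-pred zero = z≤n
fib-+-pred (suc d) = ≤-refl

fib-+ : ∀ a b → F (a + suc b) ≡ F (suc a) * F (suc b) + F a * F b
fib-+ zero b = sym (trans (+-identityʳ _) (+-identityʳ _))
fib-+ (suc zero) b = lemma (F (suc b)) (F b)
  where
  lemma : ∀ x y → x + y ≡ 1 * x + 1 * y
  lemma = solve-∀
fib-+ (suc (suc a)) b = begin
  F (suc a + suc b) + F (a + suc b)
    ≡⟨ cong₂ _+_ (fib-+ (suc a) b) (fib-+ a b) ⟩
  (F (suc a) + F a) * F (suc b) + F (suc a) * F b + (F (suc a) * F (suc b) + F a * F b)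
    ≡⟨ lemma (F (suc a)) (F a) (F (suc b)) (F b) ⟩
  (F (suc a) + F a + F (suc a)) * F (suc b) + (F (suc a) + F a) * F b ∎
  where
  open ≡-Reasoning
  lemma : ∀ x y u v → (x + y) * u + x * v + (x * u + y * v) ≡ (x + y + x) * u + (x + y) * v
  lemma = solve-∀

*-distribˡ-+-regroup : ∀ a u v s s′ → a * (u + v) + (s + s′) ≡ (a * u + s) + (a * v + s′)
*-distribˡ-+-regroup = solve-∀

*-distribʳ-+-regroup : ∀ a u v s s′ → (u + v) * a + (s + s′) ≡ (u * a + s) + (v * a + s′)
*-distribʳ-+-regroup = solve-∀

-- A signed sum Σ (−1)^e x_e is kept as the pair of sums over even and over odd e;
-- select p q x keeps x exactly when q ≡ p.
select : Parity → Parity → ℕ → ℕ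
select 0ℙ 0ℙ x = x
select 1ℙ 1ℙ x = x
select 0ℙ 1ℙ _ = 0
select 1ℙ 0ℙ _ = 0

select-self : ∀ p x → select p p x ≡ x
select-self 0ℙ x = refl
select-self 1ℙ x = refl

select-flip : ∀ p x → select (p ⁻¹) p x ≡ 0
select-flip 0ℙ x = refl
select-flip 1ℙ x = refl

select-zero : ∀ p q → select p q 0 ≡ 0
select-zero 0ℙ 0ℙ = refl
select-zero 0ℙ 1ℙ = refl
select-zero 1ℙ 0ℙ = refl
select-zero 1ℙ 1ℙ = refl

select-+ : ∀ p q x y → select p q (x + y) ≡ select p q x + select p q y
select-+ 0ℙ 0ℙ x y = refl
select-+ 0ℙ 1ℙ x y = refl
select-+ 1ℙ 0ℙ x y = refl
select-+ 1ℙ 1ℙ x y = refl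

select-≤ : ∀ p q x → select p q x ≤ x
select-≤ 0ℙ 0ℙ x = ≤-refl
select-≤ 0ℙ 1ℙ x = z≤n
select-≤ 1ℙ 0ℙ x = z≤n
select-≤ 1ℙ 1ℙ x = ≤-refl

-- Cassini's and d'Ocagne's identities F_{e+1} F_{e+r} − F_e F_{e+r+1} = (−1)^e F_r,
-- with the negative terms moved across.
cassini : ∀ e →
  F (suc e) * F (suc e) + select 1ℙ (parity e) 1 ≡ F e * F (2 + e) + select 0ℙ (parity e) 1
cassini zero = refl
cassini (suc zero) = refl
cassini (suc (suc e)) = begin
  (y + x + y) * (y + x + y) + s₁        ≡⟨ expandˡ x y s₁ ⟩
  (y * y + s₁) + c                       ≡⟨ cong (_+ c) (cassini e) ⟩
  (x * (y + x) + s₀) + c                 ≡⟨ expandʳ x y s₀ ⟩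
  (y + x) * (y + x + y + (y + x)) + s₀   ∎
  where
  open ≡-Reasoning
  x = F e
  y = F (suc e)
  c = x * x + 4 * (x * y) + 3 * (y * y)
  s₀ = select 0ℙ (parity e) 1
  s₁ = select 1ℙ (parity e) 1
  expandˡ : ∀ x y s → (y + x + y) * (y + x + y) + s ≡ (y * y + s) + (x * x + 4 * (x * y) + 3 * (y * y))
  expandˡ = solve-∀
  expandʳ : ∀ x y s →
            (x * (y + x) + s) + (x * x + 4 * (x * y) + 3 * (y * y)) ≡ (y + x) * (y + x + y + (y + x)) + s
  expandʳ = solve-∀

d'Ocagne : ∀ e r →
  F (suc e) * F (r + e) + select 1ℙ (parity e) (F r) ≡ F e * F (suc (r + e)) + select 0ℙ (parity e) (F r)
d'Ocagne e zero = begin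
  F (suc e) * F e + select 1ℙ p 0  ≡⟨ cong₂ _+_ (*-comm (F (suc e)) (F e)) (select-zero 1ℙ p) ⟩
  F e * F (suc e) + 0              ≡⟨ cong (F e * F (suc e) +_) (select-zero 0ℙ p) ⟨
  F e * F (suc e) + select 0ℙ p 0  ∎
  where
  open ≡-Reasoning
  p = parity e
d'Ocagne e (suc zero) = cassini e
d'Ocagne e (suc (suc r)) = begin
  a * (u + v) + select 1ℙ p (F (suc r) + F r)   ≡⟨ cong (a * (u + v) +_) (select-+ 1ℙ p _ _) ⟩
  a * (u + v) + (s + s′)                         ≡⟨ *-distribˡ-+-regroup a u v s s′ ⟩
  (a * u + s) + (a * v + s′)                     ≡⟨ cong₂ _+_ (d'Ocagne e (suc r)) (d'Ocagne e r) ⟩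
  (b * u′ + t) + (b * v′ + t′)                   ≡⟨ *-distribˡ-+-regroup b u′ v′ t t′ ⟨
  b * (u′ + v′) + (t + t′)                       ≡⟨ cong (b * (u′ + v′) +_) (select-+ 0ℙ p _ _) ⟨
  b * (u′ + v′) + select 0ℙ p (F (suc r) + F r)  ∎
  where
  open ≡-Reasoning
  p = parity e
  a = F (suc e)
  b = F e
  u = F (suc r + e)
  v = F (r + e)
  u′ = F (suc (suc r + e))
  v′ = F (suc (r + e))
  s = select 1ℙ p (F (suc r))
  s′ = select 1ℙ p (F r)
  t = select 0ℙ p (F (suc r))
  t′ = select 0ℙ p (F r)

d'Ocagne-∸ : ∀ {e K} → e ≤ K →
  F (suc e) * F K + select 1ℙ (parity e) (F (K ∸ e)) ≡ F e * F (suc K) + select 0ℙ (parity e) (F (K ∸ e))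
d'Ocagne-∸ {e} {K} e≤K =
  subst (λ n → F (suc e) * F n + select 1ℙ p (F (K ∸ e)) ≡ F e * F (suc n) + select 0ℙ p (F (K ∸ e)))
        (m∸n+n≡m e≤K) (d'Ocagne e (K ∸ e))
  where p = parity e

sum-linear : ∀ {f g h j : ℕ → ℕ} a b xs → All (λ x → f x * a + g x ≡ h x * b + j x) xs →
             sum (map f xs) * a + sum (map g xs) ≡ sum (map h xs) * b + sum (map j xs)
sum-linear a b [] [] = cong₂ _+_ (*-zeroˡ a) (sym (*-zeroˡ b))
sum-linear {f} {g} {h} {j} a b (x ∷ xs) (eq ∷ eqs) = begin
  (f x + sum (map f xs)) * a + (g x + sum (map g xs))
    ≡⟨ *-distribʳ-+-regroup a (f x) _ (g x) _ ⟩
  (f x * a + g x) + (sum (map f xs) * a + sum (map g xs))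
    ≡⟨ cong₂ _+_ eq (sum-linear a b xs eqs) ⟩
  (h x * b + j x) + (sum (map h xs) * b + sum (map j xs))
    ≡⟨ *-distribʳ-+-regroup b (h x) _ (j x) _ ⟨
  (h x + sum (map h xs)) * b + (j x + sum (map j xs)) ∎
  where open ≡-Reasoning

value : List ℕ → ℕ
value = sum ∘ map F

mirror : ℕ → List ℕ → ℕ
mirror K = sum ∘ map (λ e → F (K ∸ e))

mirrorOf : Parity → ℕ → List ℕ → ℕ
mirrorOf p K = sum ∘ map (λ e → select p (parity e) (F (K ∸ e)))

mirror-identity : ∀ {K} xs → All (_≤ K) xs →
  sum (map (F ∘ suc) xs) * F K + mirrorOf 1ℙ K xs ≡ value xs * F (suc K) + mirrorOf 0ℙ K xs
mirror-identity {K} xs bounded = sum-linear (F K) (F (suc K)) xs (All.map d'Ocagne-∸ bounded)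

sum-map-++ : ∀ (f : ℕ → ℕ) xs ys → sum (map f (xs ++ ys)) ≡ sum (map f xs) + sum (map f ys)
sum-map-++ f xs ys = trans (cong sum (map-++ f xs ys)) (sum-++ (map f xs) (map f ys))

value-++ : ∀ xs ys → value (xs ++ ys) ≡ value xs + value ys
value-++ = sum-map-++ F

mirrorOf-++ : ∀ p K xs ys → mirrorOf p K (xs ++ ys) ≡ mirrorOf p K xs + mirrorOf p K ys
mirrorOf-++ p K = sum-map-++ (λ e → select p (parity e) (F (K ∸ e)))

remainder-unique : ∀ a b {X u v} → a * X + u ≡ b * X + v → u < X → v < X → u ≡ v
remainder-unique a b {X@(suc _)} {u} {v} eq u<X v<X = begin
  u               ≡⟨ m<n⇒m%n≡m u<X ⟨
  u % X           ≡⟨ [m+kn]%n≡m%n u a X ⟨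
  (u + a * X) % X ≡⟨ cong (_% X) (trans (+-comm u (a * X)) (trans eq (+-comm (b * X) v))) ⟩
  (v + b * X) % X ≡⟨ [m+kn]%n≡m%n v b X ⟩
  v % X           ≡⟨ m<n⇒m%n≡m v<X ⟩
  v               ∎
  where open ≡-Reasoning

-- Both sides are congruent modulo F K by mirror-identity, and both are smaller than F K.
balance : ∀ {K} m xs ys → All (_≤ K) xs → All (_≤ K) ys → value xs ≡ m * value ys →
          mirrorOf 1ℙ K xs + m * mirrorOf 0ℙ K ys < F K →
          mirrorOf 0ℙ K xs + m * mirrorOf 1ℙ K ys < F K →
          mirrorOf 1ℙ K xs + m * mirrorOf 0ℙ K ys ≡ mirrorOf 0ℙ K xs + m * mirrorOf 1ℙ K ys
balance {K} m xs ys xs≤K ys≤K xs≡m*ys = remainder-unique A (m * B) (begin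
  A * F K + (Oxs + m * Eys)                   ≡⟨ +-assoc (A * F K) Oxs (m * Eys) ⟨
  (A * F K + Oxs) + m * Eys                   ≡⟨ cong (_+ m * Eys) (mirror-identity xs xs≤K) ⟩
  (value xs * F (suc K) + Exs) + m * Eys      ≡⟨ cong (λ v → v * F (suc K) + Exs + m * Eys) xs≡m*ys ⟩
  (m * value ys * F (suc K) + Exs) + m * Eys  ≡⟨ scale m (value ys) (F (suc K)) Exs Eys ⟩
  m * (value ys * F (suc K) + Eys) + Exs      ≡⟨ cong (λ t → m * t + Exs) (mirror-identity ys ys≤K) ⟨
  m * (B * F K + Oys) + Exs                   ≡⟨ unscale m B (F K) Oys Exs ⟩
  m * B * F K + (Exs + m * Oys)               ∎)
  where
  open ≡-Reasoning
  A = sum (map (F ∘ suc) xs)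
  B = sum (map (F ∘ suc) ys)
  Oxs = mirrorOf 1ℙ K xs
  Exs = mirrorOf 0ℙ K xs
  Oys = mirrorOf 1ℙ K ys
  Eys = mirrorOf 0ℙ K ys
  scale : ∀ m v f e e′ → (m * v * f + e) + m * e′ ≡ m * (v * f + e′) + e
  scale = solve-∀
  unscale : ∀ m b f o e → m * (b * f + o) + e ≡ m * b * f + (e + m * o)
  unscale = solve-∀

∸-gap : ∀ c i {j K} → c + i ≤ j → j ≤ K → c + (K ∸ j) ≤ K ∸ i
∸-gap c i {j} {K} c+i≤j j≤K = begin
  c + (K ∸ j)       ≤⟨ +-monoˡ-≤ (K ∸ j) (m+n≤o⇒m≤o∸n c c+i≤j) ⟩
  (j ∸ i) + (K ∸ j) ≡⟨ +-comm (j ∸ i) (K ∸ j) ⟩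
  (K ∸ j) + (j ∸ i) ≡⟨ +-∸-assoc (K ∸ j) (m+n≤o⇒n≤o c c+i≤j) ⟨
  (K ∸ j) + j ∸ i   ≡⟨ cong (_∸ i) (m∸n+n≡m j≤K) ⟩
  K ∸ i             ∎
  where open ≤-Reasoning

data Sparse : ℕ → List ℕ → Set where
  []  : ∀ {a} → Sparse a []
  _∷_ : ∀ {a e xs} → a ≤ e → Sparse (2 + e) xs → Sparse a (e ∷ xs)

sparse-weaken : ∀ {a b xs} → b ≤ a → Sparse a xs → Sparse b xs
sparse-weaken b≤a [] = []
sparse-weaken b≤a (a≤e ∷ sp) = ≤-trans b≤a a≤e ∷ sp

sparse-last< : ∀ {a b e} xs → Sparse a (e ∷ xs) → All (_< b) (e ∷ xs) → 2 * length xs + e < b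
sparse-last< [] _ (e<b ∷ []) = e<b
sparse-last< {b = b} {e} (e₂ ∷ ys) (_ ∷ sp) (_ ∷ bnd) = begin-strict
  2 * suc (length ys) + e   ≡⟨ shift (length ys) e ⟩
  2 * length ys + (2 + e)   ≤⟨ +-monoʳ-≤ (2 * length ys) (sparse-head sp) ⟩
  2 * length ys + e₂        <⟨ sparse-last< ys sp bnd ⟩
  b                         ∎
  where
  open ≤-Reasoning
  shift : ∀ n e → 2 * suc n + e ≡ 2 * n + (2 + e)
  shift = solve-∀
  sparse-head : ∀ {a e xs} → Sparse a (e ∷ xs) → a ≤ e
  sparse-head (a≤e ∷ _) = a≤e

mirrorOf-≤ : ∀ p K xs → mirrorOf p K xs ≤ mirror K xs
mirrorOf-≤ p K [] = z≤n
mirrorOf-≤ p K (e ∷ xs) = +-mono-≤ (select-≤ p (parity e) (F (K ∸ e))) (mirrorOf-≤ p K xs)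

mirror-sparse-≤ : ∀ {a K xs} → Sparse a xs → All (_≤ K) xs → mirror K xs ≤ F (suc K ∸ a)
mirror-sparse-≤ [] [] = z≤n
mirror-sparse-≤ {a} {K} (_∷_ {e = e} {xs} a≤e sp) (e≤K ∷ bnd) = begin
  F (K ∸ e) + mirror K xs        ≤⟨ +-monoʳ-≤ (F (K ∸ e)) (mirror-sparse-≤ sp bnd) ⟩
  F (K ∸ e) + F (K ∸ suc e)      ≡⟨ cong (λ n → F (K ∸ e) + F n) (pred[m∸n]≡m∸[1+n] K e) ⟨
  F (K ∸ e) + F (pred (K ∸ e))   ≤⟨ fib-+-pred (K ∸ e) ⟩
  F (suc (K ∸ e))                ≡⟨ cong F (+-∸-assoc 1 e≤K) ⟨
  F (suc K ∸ e)                  ≤⟨ fib-mono-≤ (∸-monoʳ-≤ (suc K) a≤e) ⟩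
  F (suc K ∸ a)                  ∎
  where open ≤-Reasoning

parity-cases : ∀ p q → q ≡ p ⊎ q ≡ p ⁻¹
parity-cases 0ℙ 0ℙ = inj₁ refl
parity-cases 0ℙ 1ℙ = inj₂ refl
parity-cases 1ℙ 0ℙ = inj₂ refl
parity-cases 1ℙ 1ℙ = inj₁ refl

mirrorOf-cons : ∀ {K e xs Y} →
  mirrorOf (parity e ⁻¹) K xs + Y ≤ F (K ∸ e) + mirrorOf (parity e) K xs →
  mirrorOf (parity e ⁻¹) K (e ∷ xs) + Y ≤ mirrorOf (parity e) K (e ∷ xs)
mirrorOf-cons {K} {e} {xs} {Y} le = begin
  select (p ⁻¹) p (F (K ∸ e)) + mirrorOf (p ⁻¹) K xs + Y
    ≡⟨ cong (λ t → t + mirrorOf (p ⁻¹) K xs + Y) (select-flip p _) ⟩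
  mirrorOf (p ⁻¹) K xs + Y                               ≤⟨ le ⟩
  F (K ∸ e) + mirrorOf p K xs                            ≡⟨ cong (_+ mirrorOf p K xs) (select-self p _) ⟨
  select p p (F (K ∸ e)) + mirrorOf p K xs               ∎
  where
  open ≤-Reasoning
  p = parity e

head-dominates : ∀ {a b K e} xs → Sparse a (e ∷ xs) → All (_< b) (e ∷ xs) → b ≤ K →
                 F (suc (2 * length xs) + (K ∸ b)) ≤ F (K ∸ e)
head-dominates {e = e} xs sp bnd b≤K =
  fib-mono-≤ (∸-gap (suc (2 * length xs)) e (sparse-last< xs sp bnd) b≤K)

alternating-≥ : ∀ {a b K e} xs → Sparse a (e ∷ xs) → All (_< b) (e ∷ xs) → b ≤ K →
  mirrorOf (parity e ⁻¹) K (e ∷ xs) + F (suc (2 * length xs) + (K ∸ b)) ≤ mirrorOf (parity e) K (e ∷ xs)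
alternating-≥ {K = K} {e} [] sp bnd b≤K =
  mirrorOf-cons {K} {e} {[]} (≤-trans (head-dominates [] sp bnd b≤K) (m≤m+n _ 0))
alternating-≥ {b = b} {K} {e} xs@(e₂ ∷ ys) sp@(_ ∷ sp′@(2+e≤e₂ ∷ sp″)) bnd@(_ ∷ bnd′@(e₂<b ∷ _)) b≤K
  with parity-cases (parity e) (parity e₂)
... | inj₁ same = mirrorOf-cons {K} {e} {xs} (begin
  mirrorOf (p ⁻¹) K xs + X    ≤⟨ +-mono-≤ opposite≤same (head-dominates xs sp bnd b≤K) ⟩
  mirrorOf p K xs + F (K ∸ e) ≡⟨ +-comm (mirrorOf p K xs) (F (K ∸ e)) ⟩
  F (K ∸ e) + mirrorOf p K xs ∎)
  where
  open ≤-Reasoning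
  p = parity e
  X = F (suc (2 * length xs) + (K ∸ b))
  opposite≤same : mirrorOf (p ⁻¹) K xs ≤ mirrorOf p K xs
  opposite≤same = m+n≤o⇒m≤o _ (subst (λ q → mirrorOf (q ⁻¹) K xs + _ ≤ mirrorOf q K xs) same
                                       (alternating-≥ ys sp′ bnd′ b≤K))
... | inj₂ flipped = mirrorOf-cons {K} {e} {xs} (begin
  mirrorOf (p ⁻¹) K xs + X          ≤⟨ +-monoˡ-≤ X (mirrorOf-≤ (p ⁻¹) K xs) ⟩
  mirror K xs + X                   ≤⟨ +-monoˡ-≤ X (mirror-sparse-≤ (≤-refl ∷ sp″) xs≤K) ⟩
  F (suc K ∸ e₂) + X                ≡⟨ cong (λ n → F n + X) (+-∸-assoc 1 e₂≤K) ⟩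
  F (suc (K ∸ e₂)) + X              ≡⟨ +-comm (F (suc (K ∸ e₂))) X ⟩
  X + F (suc (K ∸ e₂))              ≤⟨ fib-+-≤ {suc (2 * length xs) + (K ∸ b)} {suc (K ∸ e₂)}
                                                (∸-gap (suc (suc (2 * length xs))) e X-room b≤K)
                                                (∸-gap 3 e 3+e≤e₂ e₂≤K) ⟩
  F (K ∸ e)                         ≤⟨ m≤m+n (F (K ∸ e)) (mirrorOf p K xs) ⟩
  F (K ∸ e) + mirrorOf p K xs       ∎)
  where
  open ≤-Reasoning
  p = parity e
  X = F (suc (2 * length xs) + (K ∸ b))
  xs≤K : All (_≤ K) xs
  xs≤K = All.map (λ e<b → <⇒≤ (<-≤-trans e<b b≤K)) bnd′
  e₂≤K : e₂ ≤ K
  e₂≤K = All.head xs≤K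
  3+e≤e₂ : 3 + e ≤ e₂
  3+e≤e₂ = ≤∧≢⇒< 2+e≤e₂ (λ { refl → p≢p⁻¹ p flipped })
  X-room : suc (suc (2 * length xs)) + e ≤ b
  X-room = begin
    suc (suc (2 * suc (length ys))) + e ≡⟨ shift (length ys) e ⟩
    suc (2 * length ys + (3 + e))       ≤⟨ s≤s (+-monoʳ-≤ (2 * length ys) 3+e≤e₂) ⟩
    suc (2 * length ys + e₂)            ≤⟨ sparse-last< ys sp′ bnd′ ⟩
    b                                   ∎
    where
    shift : ∀ n e → suc (suc (2 * suc n)) + e ≡ suc (2 * n + (3 + e))
    shift = solve-∀

parity-double : ∀ i → parity (i + i) ≡ 0ℙ
parity-double i = trans (+-homo-+ i i) (p+p≡0ℙ (parity i))

lucas-identity : ∀ i r →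
  F (suc (i + i)) * lucas (suc (r + (i + i))) ≡ F (suc (r + (i + i)) + suc (i + i)) + F r
lucas-identity i r = begin
  F j * (F K + F (suc n))                  ≡⟨ *-distribˡ-+ (F j) (F K) (F (suc n)) ⟩
  F j * F K + F j * F (suc n)              ≡⟨ cong (_+ F j * F (suc n)) even-d'Ocagne ⟩
  (F (i + i) * F n + F r) + F j * F (suc n) ≡⟨ regroup (F (i + i)) (F n) (F r) (F j) (F (suc n)) ⟩
  (F (suc n) * F j + F n * F (i + i)) + F r ≡⟨ cong (_+ F r) (fib-+ n (i + i)) ⟨
  F (n + j) + F r                          ∎
  where
  open ≡-Reasoning
  j = suc (i + i)
  K = r + (i + i)
  n = suc K
  even-d'Ocagne : F j * F K ≡ F (i + i) * F n + F r
  even-d'Ocagne = trans (sym (+-identityʳ (F j * F K)))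
    (subst (λ q → F j * F K + select 1ℙ q (F r) ≡ F (i + i) * F n + select 0ℙ q (F r))
           (parity-double i) (d'Ocagne (i + i) r))
  regroup : ∀ a b c d e → (a * b + c) + d * e ≡ (e * d + b * a) + c
  regroup = solve-∀

-- With j = 2i + 1 and n = j + r, lucas-identity reads F_j L_n = F_{n+j} + F_r, so m < F_j
-- would give F_{n−1} ≤ F_r.
fib-≤-of-lucas-multiple′ : ∀ {m} i r → 1 ≤ i →
  F (suc (r + (i + i)) + suc (i + i)) ≤ F (suc (suc (r + (i + i)))) + m * lucas (suc (r + (i + i))) →
  F (suc (i + i)) ≤ m
fib-≤-of-lucas-multiple′ {m} i r 1≤i bound = ≮⇒≥ (λ m<Fj → <⇒≱ Fr<FK (FK≤Fr m<Fj))
  where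
  open ≤-Reasoning
  j = suc (i + i)
  K = r + (i + i)
  L = lucas (suc K)
  FK≤Fr : m < F j → F K ≤ F r
  FK≤Fr m<Fj = +-cancelʳ-≤ (F (suc (suc K))) (F K) (F r)
    (subst (F K + F (suc (suc K)) ≤_) (+-comm (F (suc (suc K))) (F r))
           (+-cancelʳ-≤ (m * L) L (F (suc (suc K)) + F r) (begin
             suc m * L                          ≤⟨ *-monoˡ-≤ L m<Fj ⟩
             F j * L                            ≡⟨ lucas-identity i r ⟩
             F (suc K + j) + F r                ≤⟨ +-monoˡ-≤ (F r) bound ⟩
             F (suc (suc K)) + m * L + F r      ≡⟨ swap (F (suc (suc K))) (m * L) (F r) ⟩
             F (suc (suc K)) + F r + m * L      ∎)))
    where
    swap : ∀ a b c → a + b + c ≡ a + c + b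
    swap = solve-∀
  Fr<FK : F r < F K
  Fr<FK = begin-strict
    F r                 <⟨ m<n+m (F r) (fib-suc-pos r) ⟩
    F (suc (suc r))     ≤⟨ fib-mono-≤ (subst (_≤ K) (+-comm r 2) (+-monoʳ-≤ r (+-mono-≤ 1≤i 1≤i))) ⟩
    F K                 ∎

fib-≤-of-lucas-multiple : ∀ {m n} i → 1 ≤ i → suc (i + i) ≤ n →
  F (n + suc (i + i)) ≤ F (suc n) + m * lucas n → F (suc (i + i)) ≤ m
fib-≤-of-lucas-multiple {m} {n} i 1≤i j≤n =
  subst (λ n → F (n + suc (i + i)) ≤ F (suc n) + m * lucas n → F (suc (i + i)) ≤ m)
        (trans (sym (+-suc r (i + i))) (m∸n+n≡m j≤n))
        (fib-≤-of-lucas-multiple′ i r 1≤i)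
  where r = n ∸ suc (i + i)

sparse-value-≥ : ∀ {c} xs → Sparse (suc c) xs → F (c + 2 * length xs) ≤ value xs + F c
sparse-value-≥ {c} [] [] = ≤-reflexive (cong F (+-identityʳ c))
sparse-value-≥ {c} (e ∷ ys) (c<e ∷ sp) = begin
  F (c + 2 * suc (length ys))            ≡⟨ cong F (shift c (length ys)) ⟩
  F (suc (suc c) + 2 * length ys)        ≤⟨ sparse-value-≥ ys (sparse-weaken (s≤s (s≤s c<e)) sp) ⟩
  value ys + (F (suc c) + F c)           ≤⟨ +-monoʳ-≤ (value ys) (+-monoˡ-≤ (F c) (fib-mono-≤ c<e)) ⟩
  value ys + (F e + F c)                 ≡⟨ regroup (value ys) (F e) (F c) ⟩
  F e + value ys + F c                   ∎
  where
  open ≤-Reasoning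
  shift : ∀ c n → c + 2 * suc n ≡ suc (suc c) + 2 * n
  shift = solve-∀
  regroup : ∀ v a b → v + (a + b) ≡ a + v + b
  regroup = solve-∀

split-at : ∀ {a} b xs → Sparse a xs →
           ∃₂ λ lo hi → xs ≡ lo ++ hi × Sparse a lo × All (_< b) lo × Sparse b hi
split-at b [] [] = [] , [] , refl , [] , [] , []
split-at b (e ∷ xs) (a≤e ∷ sp) with e <? b
... | no e≮b = [] , e ∷ xs , refl , [] , [] , ≮⇒≥ e≮b ∷ sp
... | yes e<b with split-at b xs sp
...   | lo , hi , refl , sp-lo , lo<b , sp-hi = e ∷ lo , hi , refl , a≤e ∷ sp-lo , e<b ∷ lo<b , sp-hi

value<fib⇒bounded : ∀ {c} xs → value xs < F c → All (_< c) xs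
value<fib⇒bounded [] _ = []
value<fib⇒bounded (e ∷ xs) v<Fc =
  fib-cancel-< (≤-<-trans (m≤m+n (F e) (value xs)) v<Fc) ∷
  value<fib⇒bounded xs (≤-<-trans (m≤n+m (value xs) (F e)) v<Fc)

-- A block of q ≥ 2 digits forces F_{2q−1} ≤ m.
LengthBound : ℕ → ℕ → Set
LengthBound m q = ∀ i → q ≡ suc (suc i) → F (suc (suc i + suc i)) ≤ m

lengthBound-⊔ : ∀ {m q p} → LengthBound m q → LengthBound m p → LengthBound m (q ⊔ p)
lengthBound-⊔ {m} {q} {p} bq bp with ⊔-sel q p
... | inj₁ q⊔p≡q = subst (LengthBound m) (sym q⊔p≡q) bq
... | inj₂ q⊔p≡p = subst (LengthBound m) (sym q⊔p≡p) bp

lucas+3fib : ∀ n → lucas n + 3 * F n ≡ 2 * F (2 + n)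
lucas+3fib zero = refl
lucas+3fib (suc n) = identity (F n) (F (suc n))
  where
  identity : ∀ x y → x + (y + x) + 3 * y ≡ 2 * (y + x + y)
  identity = solve-∀

5*square<square : ∀ {f w} → 1 ≤ f → 3 * f ≤ w → 5 * (f * f) < w * w
5*square<square {f} {w} 1≤f 3f≤w = begin-strict
  5 * (f * f)                 <⟨ m<m+n (5 * (f * f)) (≤-trans (*-mono-≤ 1≤f 1≤f) (m≤m+n (f * f) _)) ⟩
  5 * (f * f) + 4 * (f * f)   ≡⟨ nine f ⟩
  (3 * f) * (3 * f)           ≤⟨ *-mono-≤ 3f≤w 3f≤w ⟩
  w * w                       ∎
  where
  open ≤-Reasoning
  nine : ∀ f → 5 * (f * f) + 4 * (f * f) ≡ (3 * f) * (3 * f)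
  nine = solve-∀

phiPowLt-of-fib : ∀ n {m} → F (2 + n) ≤ m → 2 ≤ m → PhiPowLt n m
phiPowLt-of-fib zero {m} _ 2≤m = 2<2m , *-mono-≤ 1≤2m∸2 1≤2m∸2
  where
  2<2m : 2 < 2 * m
  2<2m = ≤-trans (n≤1+n 3) (*-monoʳ-≤ 2 2≤m)
  1≤2m∸2 : 1 ≤ 2 * m ∸ 2
  1≤2m∸2 = m+n≤o⇒m≤o∸n 1 2<2m
phiPowLt-of-fib (suc n) {m} F≤m _ = L<2m , 5*square<square (fib-suc-pos n) 3F≤2m∸L
  where
  L = lucas (suc n)
  L+3F≤2m : L + 3 * F (suc n) ≤ 2 * m
  L+3F≤2m = subst (_≤ 2 * m) (sym (lucas+3fib (suc n))) (*-monoʳ-≤ 2 F≤m)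
  L<2m : L < 2 * m
  L<2m = <-≤-trans (m<m+n L (≤-trans (fib-suc-pos n) (m≤m+n (F (suc n)) _))) L+3F≤2m
  3F≤2m∸L : 3 * F (suc n) ≤ 2 * m ∸ L
  3F≤2m∸L = m+n≤o⇒m≤o∸n (3 * F (suc n)) (subst (_≤ 2 * m) (+-comm L (3 * F (suc n))) L+3F≤2m)

phiPowLt-of-length : ∀ {m s r} → 3 ≤ s → s ≤ r + r → LengthBound m r → PhiPowLt (s ∸ 3) m
phiPowLt-of-length {r = zero} (s≤s _) () _
phiPowLt-of-length {r = suc zero} (s≤s (s≤s (s≤s _))) (s≤s (s≤s ())) _
phiPowLt-of-length {s = suc (suc (suc t))} {suc (suc i)} (s≤s (s≤s (s≤s _))) (s≤s (s≤s s≤r+r)) bound =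
  phiPowLt-of-fib t (≤-trans (fib-mono-≤ index≤) Fj≤m) (≤-trans (fib-mono-≤ 3≤j) Fj≤m)
  where
  Fj≤m = bound i refl
  index≤ : 2 + t ≤ suc (suc i + suc i)
  index≤ = s≤s (s≤s (s≤s⁻¹ (subst (suc t ≤_) (+-suc i (suc i)) s≤r+r)))
  3≤j : 3 ≤ suc (suc i + suc i)
  3≤j = s≤s (s≤s (≤-trans (s≤s z≤n) (m≤n+m (suc i) i)))

positions : ℕ → List Bool → List ℕ
positions j [] = []
positions j (true ∷ ds) = j ∷ positions (suc j) ds
positions j (false ∷ ds) = positions (suc j) ds

zval-positions : ∀ j ds → zval j ds ≡ value (positions j ds)
zval-positions j [] = refl
zval-positions j (true ∷ ds) = cong (F j +_) (zval-positions (suc j) ds)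
zval-positions j (false ∷ ds) = zval-positions (suc j) ds

digitSum-positions : ∀ j ds → digitSum ds ≡ length (positions j ds)
digitSum-positions j [] = refl
digitSum-positions j (true ∷ ds) = cong suc (digitSum-positions (suc j) ds)
digitSum-positions j (false ∷ ds) = digitSum-positions (suc j) ds

noAdjacent-sparse : ∀ j ds → NoAdjacent ds → Sparse j (positions j ds)
noAdjacent-sparse j [] _ = []
noAdjacent-sparse j (false ∷ ds) na = sparse-weaken (n≤1+n j) (noAdjacent-sparse (suc j) ds na)
noAdjacent-sparse j (true ∷ []) _ = ≤-refl ∷ []
noAdjacent-sparse j (true ∷ false ∷ ds) na = ≤-refl ∷ noAdjacent-sparse (2 + j) ds na

-- The Lucas index is n = k + 1 and K = 2n; D₀ = {n − 1, n + 1} is the expansion of L_n, and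
-- x<F keeps every digit of m L_n below 2k.
module Digits (m k : ℕ) (x<F : m * lucas (suc k) < F (k + k)) where

  n K : ℕ
  n = suc k
  K = suc (suc (k + k))

  D₀ : List ℕ
  D₀ = k ∷ suc (suc k) ∷ []

  value-D₀ : value D₀ ≡ lucas n
  value-D₀ = cong (F k +_) (+-identityʳ _)

  mirror-D₀ : mirror K D₀ ≡ lucas n
  mirror-D₀ = begin
    F (K ∸ k) + (F (K ∸ suc (suc k)) + 0)
      ≡⟨ cong₂ (λ a b → F a + (F b + 0)) (m+n∸n≡m (suc (suc k)) k) (m+n∸n≡m k k) ⟩
    F (suc (suc k)) + (F k + 0)           ≡⟨ cong (F (suc (suc k)) +_) (+-identityʳ (F k)) ⟩
    F (suc (suc k)) + F k                 ≡⟨ +-comm (F (suc (suc k))) (F k) ⟩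
    lucas n                               ∎
    where open ≡-Reasoning

  D₀≤K : All (_≤ K) D₀
  D₀≤K = ≤-trans (m≤m+n k k) (≤-trans (n≤1+n _) (n≤1+n _)) ∷ s≤s (s≤s (m≤m+n k k)) ∷ []

  m*mirrorOf-D₀≤ : ∀ p → m * mirrorOf p K D₀ ≤ m * lucas n
  m*mirrorOf-D₀≤ p = *-monoʳ-≤ m (subst (mirrorOf p K D₀ ≤_) mirror-D₀ (mirrorOf-≤ p K D₀))

  Balanced : List ℕ → List ℕ → Set
  Balanced lo hi = ∀ p →
    mirrorOf p K lo + (mirrorOf p K hi + m * mirrorOf (p ⁻¹) K D₀) ≡
    mirrorOf (p ⁻¹) K lo + (mirrorOf (p ⁻¹) K hi + m * mirrorOf p K D₀)

  balanced : ∀ lo hi → Sparse 2 (lo ++ hi) → All (_≤ K) (lo ++ hi) → value (lo ++ hi) ≡ m * lucas n →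
             Balanced lo hi
  balanced lo hi sp D≤K vD p = begin
    M p lo + (M p hi + m * M (p ⁻¹) D₀)       ≡⟨ +-assoc (M p lo) _ _ ⟨
    M p lo + M p hi + m * M (p ⁻¹) D₀         ≡⟨ cong (_+ m * M (p ⁻¹) D₀) (mirrorOf-++ p K lo hi) ⟨
    M p D + m * M (p ⁻¹) D₀                   ≡⟨ balance-at p ⟩
    M (p ⁻¹) D + m * M p D₀                   ≡⟨ cong (_+ m * M p D₀) (mirrorOf-++ (p ⁻¹) K lo hi) ⟩
    M (p ⁻¹) lo + M (p ⁻¹) hi + m * M p D₀    ≡⟨ +-assoc (M (p ⁻¹) lo) _ _ ⟩
    M (p ⁻¹) lo + (M (p ⁻¹) hi + m * M p D₀)  ∎
    where
    open ≡-Reasoning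
    D = lo ++ hi
    M : Parity → List ℕ → ℕ
    M p = mirrorOf p K
    <F : ∀ q → M q D + m * M (q ⁻¹) D₀ < F K
    <F q = +-mono-≤-< (≤-trans (mirrorOf-≤ q K D) (mirror-sparse-≤ sp D≤K))
                      (≤-<-trans (m*mirrorOf-D₀≤ (q ⁻¹)) x<F)
    odd-balance : M 1ℙ D + m * M 0ℙ D₀ ≡ M 0ℙ D + m * M 1ℙ D₀
    odd-balance = balance m D D₀ D≤K D₀≤K (trans vD (cong (m *_) (sym value-D₀))) (<F 1ℙ) (<F 0ℙ)
    balance-at : ∀ p → M p D + m * M (p ⁻¹) D₀ ≡ M (p ⁻¹) D + m * M p D₀
    balance-at 0ℙ = sym odd-balance
    balance-at 1ℙ = odd-balance

  n≤K : n ≤ K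
  n≤K = s≤s (≤-trans (m≤m+n k k) (n≤1+n _))

  low-lengthBound : ∀ {a} lo hi → Sparse a lo → All (_< n) lo → Sparse n hi → All (_≤ K) hi →
                    Balanced lo hi → LengthBound m (length lo)
  low-lengthBound (e ∷ xs) hi sp-lo lo<n sp-hi hi≤K bal i |lo|≡2+i =
    fib-≤-of-lucas-multiple (suc i) (s≤s z≤n) j≤n (begin
      F (n + j)                                  ≡⟨ cong F index ⟩
      F (suc (2 * length xs) + (K ∸ n))          ≤⟨ +-cancelˡ-≤ (M (p ⁻¹) lo) _ _ dominated ⟩
      F (suc n) + m * lucas n                    ∎)
    where
    open ≤-Reasoning
    lo = e ∷ xs
    p = parity e
    j = suc (suc i + suc i)
    M : Parity → List ℕ → ℕ
    M p = mirrorOf p K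
    X = F (suc (2 * length xs) + (K ∸ n))
    |xs|≡1+i : length xs ≡ suc i
    |xs|≡1+i = suc-injective |lo|≡2+i
    index : n + j ≡ suc (2 * length xs) + (K ∸ n)
    index = trans (shift k i) (cong₂ (λ l t → suc (2 * l) + t) (sym |xs|≡1+i) (sym (m+n∸n≡m (suc k) k)))
      where
      shift : ∀ k i → suc k + suc (suc i + suc i) ≡ suc (2 * suc i) + suc k
      shift = solve-∀
    j≤n : j ≤ n
    j≤n = begin
      suc (suc i + suc i)       ≡⟨ cong (λ l → suc (l + l)) |xs|≡1+i ⟨
      suc (length xs + length xs) ≡⟨ cong (λ t → suc (length xs + t)) (+-identityʳ (length xs)) ⟨
      suc (2 * length xs)       ≤⟨ s≤s (m≤m+n (2 * length xs) e) ⟩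
      suc (2 * length xs + e)   ≤⟨ sparse-last< xs sp-lo lo<n ⟩
      n                         ∎
    hi-mirror≤ : M (p ⁻¹) hi ≤ F (suc n)
    hi-mirror≤ = ≤-trans (mirrorOf-≤ (p ⁻¹) K hi)
                         (subst (λ t → mirror K hi ≤ F t) (m+n∸n≡m (suc (suc k)) k)
                                (mirror-sparse-≤ sp-hi hi≤K))
    dominated : M (p ⁻¹) lo + X ≤ M (p ⁻¹) lo + (F (suc n) + m * lucas n)
    dominated = begin
      M (p ⁻¹) lo + X                                   ≤⟨ alternating-≥ xs sp-lo lo<n n≤K ⟩
      M p lo                                            ≤⟨ m≤m+n (M p lo) _ ⟩
      M p lo + (M p hi + m * M (p ⁻¹) D₀)               ≡⟨ bal p ⟩
      M (p ⁻¹) lo + (M (p ⁻¹) hi + m * M p D₀)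
        ≤⟨ +-monoʳ-≤ (M (p ⁻¹) lo) (+-mono-≤ hi-mirror≤ (m*mirrorOf-D₀≤ p)) ⟩
      M (p ⁻¹) lo + (F (suc n) + m * lucas n)           ∎

  high-lengthBound : ∀ hi → Sparse n hi → All (_< k + k) hi → value hi ≤ m * lucas n → LengthBound m (length hi)
  high-lengthBound hi@(e ∷ ys) sp@(n≤e ∷ _) hi<2k hi≤x i |hi|≡2+i =
    fib-≤-of-lucas-multiple (suc i) (s≤s z≤n) j≤n (begin
      F (n + j)                        ≡⟨ cong F index ⟩
      F (k + 2 * length hi)            ≤⟨ sparse-value-≥ hi sp ⟩
      value hi + F k                   ≤⟨ +-mono-≤ hi≤x (fib-mono-≤ (≤-trans (n≤1+n k) (n≤1+n n))) ⟩
      m * lucas n + F (suc n)          ≡⟨ +-comm (m * lucas n) (F (suc n)) ⟩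
      F (suc n) + m * lucas n          ∎)
    where
    open ≤-Reasoning
    j = suc (suc i + suc i)
    |ys|≡1+i : suc i ≡ length ys
    |ys|≡1+i = sym (suc-injective |hi|≡2+i)
    index : n + j ≡ k + 2 * length hi
    index = trans (shift k i) (cong (λ l → k + 2 * l) (sym |hi|≡2+i))
      where
      shift : ∀ k i → suc k + suc (suc i + suc i) ≡ k + 2 * suc (suc i)
      shift = solve-∀
    1+j+k≤2k : suc j + k ≤ k + k
    1+j+k≤2k = begin
      suc j + k                        ≡⟨ shift k i ⟩
      suc (2 * suc i + suc k)          ≤⟨ s≤s (+-mono-≤ (≤-reflexive (cong (2 *_) |ys|≡1+i)) n≤e) ⟩
      suc (2 * length ys + e)          ≤⟨ sparse-last< ys sp hi<2k ⟩
      k + k                            ∎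
      where
      shift : ∀ k i → suc (suc (suc i + suc i)) + k ≡ suc (2 * suc i + suc k)
      shift = solve-∀
    j≤n : j ≤ n
    j≤n = ≤-trans (n≤1+n j) (≤-trans (+-cancelʳ-≤ k (suc j) k 1+j+k≤2k) (n≤1+n k))

  positions-bound : ∀ D → Sparse 2 D → value D ≡ m * lucas n → 3 ≤ length D → PhiPowLt (length D ∸ 3) m
  positions-bound D sp vD 3≤|D| with split-at n D sp
  ... | lo , hi , refl , sp-lo , lo<n , sp-hi =
    phiPowLt-of-length 3≤|D| |D|≤ (lengthBound-⊔ {m} {length lo} {length hi}
      (low-lengthBound lo hi sp-lo lo<n sp-hi hi≤K (balanced lo hi sp D≤K vD))
      (high-lengthBound hi sp-hi hi<2k hi≤x))
    where
    D<2k : All (_< k + k) (lo ++ hi)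
    D<2k = value<fib⇒bounded (lo ++ hi) (subst (_< F (k + k)) (sym vD) x<F)
    <2k⇒≤K : ∀ {e} → e < k + k → e ≤ K
    <2k⇒≤K e<2k = ≤-trans (<⇒≤ e<2k) (≤-trans (n≤1+n _) (n≤1+n _))
    D≤K : All (_≤ K) (lo ++ hi)
    D≤K = All.map <2k⇒≤K D<2k
    hi<2k : All (_< k + k) hi
    hi<2k = ++⁻ʳ lo D<2k
    hi≤K : All (_≤ K) hi
    hi≤K = All.map <2k⇒≤K hi<2k
    hi≤x : value hi ≤ m * lucas n
    hi≤x = subst (value hi ≤_) (trans (sym (value-++ lo hi)) vD) (m≤n+m (value hi) (value lo))
    |D|≤ : length (lo ++ hi) ≤ (length lo ⊔ length hi) + (length lo ⊔ length hi)
    |D|≤ = subst (_≤ (length lo ⊔ length hi) + (length lo ⊔ length hi)) (sym (length-++ lo))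
                 (+-mono-≤ (m≤m⊔n (length lo) (length hi)) (m≤n⊔m (length lo) (length hi)))

  digitSum-bound : ∀ ds → IsZeckendorf (m * lucas n) ds → digitSum ds < 3 ⊎ PhiPowLt (digitSum ds ∸ 3) m
  digitSum-bound ds (no-adjacent , _ , zval≡x) with digitSum ds <? 3
  ... | yes s<3 = inj₁ s<3
  ... | no s≮3 = inj₂ (subst (λ s → PhiPowLt (s ∸ 3) m) (sym |ds|)
                            (positions-bound D (noAdjacent-sparse 2 ds no-adjacent) value≡x 3≤|D|))
    where
    D = positions 2 ds
    |ds| : digitSum ds ≡ length D
    |ds| = digitSum-positions 2 ds
    value≡x : value D ≡ m * lucas n
    value≡x = trans (sym (zval-positions 2 ds)) zval≡x
    3≤|D| : 3 ≤ length D
    3≤|D| = subst (3 ≤_) |ds| (≮⇒≥ s≮3)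

lucas-multiple<fib : ∀ {m k} → 4 + m ≤ k → m * lucas (suc k) < F (k + k)
lucas-multiple<fib {m} {k@(suc (suc (suc (suc t))))} (s≤s (s≤s (s≤s (s≤s m≤t)))) = begin-strict
  m * lucas (suc k)                                  ≤⟨ *-monoʳ-≤ m lucas≤fib ⟩
  m * F (3 + k)                                      <⟨ m<n+m (m * F (3 + k)) (fib-suc-pos (2 + k)) ⟩
  suc m * F (3 + k)                                  ≤⟨ *-monoˡ-≤ (F (3 + k)) (≤-<-trans m≤t (n<fib-2+n t)) ⟩
  F (2 + t) * F (3 + k)                              ≡⟨ *-comm (F (2 + t)) (F (3 + k)) ⟩
  F (3 + k) * F (2 + t)                              ≤⟨ m≤m+n _ _ ⟩
  F (3 + k) * F (2 + t) + F (2 + k) * F (1 + t)      ≡⟨ fib-+ (2 + k) (1 + t) ⟨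
  F ((2 + k) + (2 + t))                              ≡⟨ cong F (shift t) ⟩
  F (k + k)                                          ∎
  where
  open ≤-Reasoning
  shift : ∀ t → (6 + t) + (2 + t) ≡ (4 + t) + (4 + t)
  shift = solve-∀
  lucas≤fib : lucas (suc k) ≤ F (3 + k)
  lucas≤fib = subst (lucas (suc k) ≤_) (+-comm (F (suc k)) (F (2 + k))) (+-monoˡ-≤ (F (2 + k)) (fib-≤-suc k))

lemma3 : (m : ℕ) → 1 ≤ m → ∃ λ k₀ → (k : ℕ) → k₀ ≤ k →
           (ds : List Bool) → IsZeckendorf (m * lucas k) ds →
           (digitSum ds < 3) ⊎ PhiPowLt (digitSum ds ∸ 3) m
lemma3 m _ = 5 + m , λ { (suc k) (s≤s 4+m≤k) → Digits.digitSum-bound m k (lucas-multiple<fib 4+m≤k) }
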